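{- Let $G$ be a graph of order at least $4$ obtained from a triangle $xyz$ by appending leaves to $x$, $y$, or $z$ (i.e., adding new vertices, each adjacent to exactly one of $x,y,z$). Then $G$ is not well-edge-dominated.
   Context: All graphs are simple and finite. A set $F$ of edges of $G$ is an edge dominating set if every edge of $G$ is in $F$ or shares an endpoint with an edge of $F$. $G$ is well-edge-dominated if all minimal (with respect to inclusion) edge dominating sets of $G$ have the same cardinality. -}

module Defs where

open import Data.Nat using (ℕ; zero; suc; _+_; _∸_; _<ᵇ_; _≡ᵇ_)
open import Data.Bool using (Bool; true; false; if_then_else_; _∧_; _∨_; not)
open import Data.Fin using (Fin; toℕ; _<_)
open import Data.Product using (_×_; ∃; ∃-syntax)
open import Data.Sum using (_⊎_)
open import Relation.Binary.PropositionalEquality using (_≡_)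
open import Relation.Nullary using (¬_)

-- A finite simple graph on vertex set Fin n, given by a Boolean adjacency
-- relation (intended symmetric and irreflexive).
record Graph : Set where
  field
    n   : ℕ
    adj : Fin n → Fin n → Bool
open Graph public

ΣFin : (m : ℕ) → (Fin m → ℕ) → ℕ
ΣFin zero    f = 0
ΣFin (suc m) f = f Fin.zero + ΣFin m (λ i → f (Fin.suc i))

module _ (G : Graph) where

  -- Edge {u,v} of G, recorded canonically as the pair (u , v) with u < v.
  Edge : Fin (n G) → Fin (n G) → Set
  Edge u v = (u < v) × (adj G u v ≡ true)

  PairSet : Set
  PairSet = Fin (n G) → Fin (n G) → Bool

  IsEdgeSet : PairSet → Set
  IsEdgeSet F = ∀ u v → F u v ≡ true → Edge u v

  _⊆_ : PairSet → PairSet → Set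
  F ⊆ F′ = ∀ u v → F u v ≡ true → F′ u v ≡ true

  -- number of elements of F (each edge counted once, as pair with u < v)
  card : PairSet → ℕ
  card F = ΣFin (n G) (λ u → ΣFin (n G) (λ v → if F u v then 1 else 0))

  IsEdgeDominating : PairSet → Set
  IsEdgeDominating F =
    IsEdgeSet F ×
    (∀ u v → Edge u v →
       F u v ≡ true ⊎
       ∃[ a ] ∃[ b ] (F a b ≡ true × (a ≡ u ⊎ a ≡ v ⊎ b ≡ u ⊎ b ≡ v)))

  IsMinimalEDS : PairSet → Set
  IsMinimalEDS F =
    IsEdgeDominating F × (∀ F′ → F′ ⊆ F → IsEdgeDominating F′ → F ⊆ F′)

  WellEdgeDominated : Set
  WellEdgeDominated =
    ∀ F F′ → IsMinimalEDS F → IsMinimalEDS F′ → card F ≡ card F′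

-- The graph obtained from a triangle xyz by appending a leaves to x,
-- b leaves to y and c leaves to z.  Vertices: 0 = x, 1 = y, 2 = z,
-- 3 .. 3+a-1 leaves at x, next b leaves at y, last c leaves at z.
anchor : ℕ → ℕ → ℕ → ℕ
anchor a b m = if ((m ∸ 3) <ᵇ a) then 0 else (if ((m ∸ 3) <ᵇ (a + b)) then 1 else 2)

adjℕ : ℕ → ℕ → ℕ → ℕ → Bool
adjℕ a b u v =
  ((u <ᵇ 3) ∧ (v <ᵇ 3) ∧ not (u ≡ᵇ v)) ∨
  (not (u <ᵇ 3) ∧ (anchor a b u ≡ᵇ v)) ∨
  (not (v <ᵇ 3) ∧ (anchor a b v ≡ᵇ u))

triangleWithLeaves : ℕ → ℕ → ℕ → Graph
triangleWithLeaves a b c = record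
  { n   = 3 + a + b + c
  ; adj = λ u v → adjℕ a b (toℕ u) (toℕ v) }

{-# OPTIONS --safe #-}
-- A maximal matching M is an edge dominating set, and a minimal one: if F ⊆ M still
-- dominates, an edge e ∈ M missing from F would have to meet another edge of M.  So it
-- suffices to exhibit two maximal matchings of different sizes.  If some triangle vertex
-- has no leaf, the triangle edge opposite it is a maximal matching on its own, while a
-- pendant edge at a vertex w plus the triangle edge opposite w is one of size 2.  If every
-- triangle vertex has a leaf, that size-2 matching competes with three pendant edges.
module Submission where

open import Defs
open import Data.Bool using (Bool; true; false; if_then_else_; _∧_; _∨_)
open import Data.Bool.Properties using (T-≡)
open import Data.Empty using (⊥-elim)
open import Data.Fin using (Fin; zero; suc; toℕ; fromℕ<; #_)
open import Data.Fin.Properties using (_≟_; toℕ-injective; toℕ-fromℕ<; toℕ<n)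
open import Data.List using (List; []; _∷_; length)
open import Data.List.Membership.Propositional using (_∈_; find)
open import Data.List.Relation.Unary.All as All using (All; []; _∷_)
open import Data.List.Relation.Unary.All.Properties using (All¬⇒¬Any)
open import Data.List.Relation.Unary.AllPairs as AllPairs using (AllPairs; []; _∷_)
open import Data.List.Relation.Unary.Any as Any using (Any; here; there)
open import Data.List.Relation.Unary.Unique.Propositional using (Unique)
open import Data.Nat using (ℕ; zero; suc; _+_; _∸_; _≤_; _<_; _≡ᵇ_; _<ᵇ_; z≤n; s≤s; z<s; s<s)
  renaming (_≟_ to _≟ℕ_)
open import Data.Nat.Properties
  using ( +-0-commutativeMonoid; ≡ᵇ⇒≡; <ᵇ-reflects-<; ≮⇒≥; <⇒≱; <⇒≢; +-identityʳ
        ; m≤m+n; m<m+n; ≤-refl; ≤-trans; <-≤-trans)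
open import Algebra.Properties.CommutativeMonoid.Sum +-0-commutativeMonoid
  using (sum; sum-syntax; ∑-distrib-+; sum-cong-≗; sum-replicate-zero)
open import Data.Product using (_×_; _,_; proj₁; proj₂; uncurry; ∃-syntax)
open import Data.Product.Properties using (,-injective)
open import Data.Sum using (_⊎_; inj₁; inj₂)
open import Function using (_∘_; Equivalence)
open import Relation.Binary.Definitions using (DecidableEquality)
open import Relation.Binary.PropositionalEquality
open import Relation.Nullary using (¬_; yes; no; does)
open import Relation.Nullary.Decidable using (map′; _×-dec_; dec-true; dec-false)
open import Relation.Nullary.Reflects using (ofʸ; ofⁿ)

ind : Bool → ℕ
ind b = if b then 1 else 0

ind-∨ : ∀ {x y} → (x ≡ true → y ≡ false) → ind (x ∨ y) ≡ ind x + ind y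
ind-∨ {true}  y-false rewrite y-false refl = refl
ind-∨ {false} _ = refl

ΣFin≡sum : ∀ m (f : Fin m → ℕ) → ΣFin m f ≡ sum f
ΣFin≡sum zero    f = refl
ΣFin≡sum (suc m) f = cong (f zero +_) (ΣFin≡sum m (f ∘ suc))

sum-δ : ∀ {m} (p : Fin m) → ∑[ i < m ] ind (does (i ≟ p)) ≡ 1
sum-δ {suc m} zero    = cong suc (sum-replicate-zero m)
sum-δ {suc m} (suc p) = sum-δ p

module _ (G : Graph) where

  Vertex : Set
  Vertex = Fin (n G)

  VertexPair : Set
  VertexPair = Vertex × Vertex

  card≡∑∑ : ∀ F → card G F ≡ ∑[ u < n G ] ∑[ v < n G ] ind (F u v)
  card≡∑∑ F = trans (ΣFin≡sum (n G) _) (sum-cong-≗ {n G} λ u → ΣFin≡sum (n G) (λ v → ind (F u v)))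

  card-∅ : card G (λ _ _ → false) ≡ 0
  card-∅ = trans (card≡∑∑ _)
    (trans (sum-cong-≗ {n G} λ _ → sum-replicate-zero (n G)) (sum-replicate-zero (n G)))

  card-∨ : ∀ F F′ → (∀ u v → F u v ≡ true → F′ u v ≡ false) →
           card G (λ u v → F u v ∨ F′ u v) ≡ card G F + card G F′
  card-∨ F F′ disjoint = begin
    card G (λ u v → F u v ∨ F′ u v)
      ≡⟨ card≡∑∑ _ ⟩
    ∑[ u < n G ] ∑[ v < n G ] ind (F u v ∨ F′ u v)
      ≡⟨ sum-cong-≗ {n G} (λ u → sum-cong-≗ {n G} λ v → ind-∨ (disjoint u v)) ⟩
    ∑[ u < n G ] ∑[ v < n G ] (ind (F u v) + ind (F′ u v))
      ≡⟨ sum-cong-≗ {n G} (λ u → ∑-distrib-+ (λ v → ind (F u v)) (λ v → ind (F′ u v))) ⟩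
    ∑[ u < n G ] (∑[ v < n G ] ind (F u v) + ∑[ v < n G ] ind (F′ u v))
      ≡⟨ ∑-distrib-+ (λ u → ∑[ v < n G ] ind (F u v)) (λ u → ∑[ v < n G ] ind (F′ u v)) ⟩
    ∑[ u < n G ] ∑[ v < n G ] ind (F u v) + ∑[ u < n G ] ∑[ v < n G ] ind (F′ u v)
      ≡⟨ sym (cong₂ _+_ (card≡∑∑ F) (card≡∑∑ F′)) ⟩
    card G F + card G F′ ∎
    where open ≡-Reasoning

  card-singleton : ∀ p q → card G (λ u v → does (u ≟ p) ∧ does (v ≟ q)) ≡ 1
  card-singleton p q = begin
    card G (λ u v → does (u ≟ p) ∧ does (v ≟ q))         ≡⟨ card≡∑∑ _ ⟩
    ∑[ u < n G ] ∑[ v < n G ] ind (does (u ≟ p) ∧ does (v ≟ q)) ≡⟨ sum-cong-≗ {n G} row ⟩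
    ∑[ u < n G ] ind (does (u ≟ p))                         ≡⟨ sum-δ p ⟩
    1 ∎
    where
    open ≡-Reasoning
    row : ∀ u → ∑[ v < n G ] ind (does (u ≟ p) ∧ does (v ≟ q)) ≡ ind (does (u ≟ p))
    row u with does (u ≟ p)
    ... | true  = sum-δ q
    ... | false = sum-replicate-zero (n G)

  -- Built with _×-dec_ (rather than Data.Product.Properties.≡-dec) so that
  -- pairSet ((p , q) ∷ L) u v unfolds to does (u ≟ p) ∧ does (v ≟ q) ∨ pairSet L u v.
  _≟ᵖ_ : DecidableEquality VertexPair
  (u , v) ≟ᵖ (p , q) = map′ (uncurry (cong₂ _,_)) ,-injective ((u ≟ p) ×-dec (v ≟ q))

  open import Data.List.Membership.DecPropositional _≟ᵖ_ using (_∈?_)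

  pairSet : List VertexPair → PairSet G
  pairSet L u v = does ((u , v) ∈? L)

  pairSet⁺ : ∀ {L u v} → (u , v) ∈ L → pairSet L u v ≡ true
  pairSet⁺ {L} {u} {v} = dec-true ((u , v) ∈? L)

  pairSet⁻ : ∀ {L u v} → pairSet L u v ≡ true → (u , v) ∈ L
  pairSet⁻ {L} {u} {v} eq with (u , v) ∈? L
  ... | yes uv∈L = uv∈L

  card-pairSet : ∀ {L} → Unique L → card G (pairSet L) ≡ length L
  card-pairSet {[]}          []          = card-∅
  card-pairSet {(p , q) ∷ L} (pq∉L ∷ uL) =
    trans (card-∨ _ _ pq∉pairSet) (cong₂ _+_ (card-singleton p q) (card-pairSet uL))
    where
    pq∉pairSet : ∀ u v → does (u ≟ p) ∧ does (v ≟ q) ≡ true → pairSet L u v ≡ false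
    pq∉pairSet u v eq with u ≟ p | v ≟ q
    ... | yes refl | yes refl = dec-false ((p , q) ∈? L) (All¬⇒¬Any pq∉L)

  Meets : VertexPair → VertexPair → Set
  Meets (p , q) (u , v) = p ≡ u ⊎ p ≡ v ⊎ q ≡ u ⊎ q ≡ v

  meets-sym : ∀ e f → Meets e f → Meets f e
  meets-sym _ _ (inj₁ p≡u)                 = inj₁ (sym p≡u)
  meets-sym _ _ (inj₂ (inj₁ p≡v))          = inj₂ (inj₂ (inj₁ (sym p≡v)))
  meets-sym _ _ (inj₂ (inj₂ (inj₁ q≡u)))   = inj₂ (inj₁ (sym q≡u))
  meets-sym _ _ (inj₂ (inj₂ (inj₂ q≡v)))   = inj₂ (inj₂ (inj₂ (sym q≡v)))

  Disjoint : VertexPair → VertexPair → Set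
  Disjoint e f = ¬ Meets e f

  disjoint : ∀ {p q u v} → p ≢ u → p ≢ v → q ≢ u → q ≢ v → Disjoint (p , q) (u , v)
  disjoint p≢u _ _ _ (inj₁ p≡u)               = p≢u p≡u
  disjoint _ p≢v _ _ (inj₂ (inj₁ p≡v))        = p≢v p≡v
  disjoint _ _ q≢u _ (inj₂ (inj₂ (inj₁ q≡u))) = q≢u q≡u
  disjoint _ _ _ q≢v (inj₂ (inj₂ (inj₂ q≡v))) = q≢v q≡v

  IsEdge : VertexPair → Set
  IsEdge (u , v) = Edge G u v

  Dominating : List VertexPair → Set
  Dominating L = ∀ u v → Edge G u v → Any (λ e → Meets e (u , v)) L

  record MaximalMatching : Set where
    field
      edges             : List VertexPair
      all-edges         : All IsEdge edges
      pairwise-disjoint : AllPairs Disjoint edges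
      dominating        : Dominating edges

  pairwise-disjoint⇒unique : ∀ {L} → AllPairs Disjoint L → Unique L
  pairwise-disjoint⇒unique = AllPairs.map λ { e∦f refl → e∦f (inj₁ refl) }

  pairwise-disjoint-meets⇒≡ : ∀ {L e f} → AllPairs Disjoint L → e ∈ L → f ∈ L → Meets e f → e ≡ f
  pairwise-disjoint-meets⇒≡ _              (here refl) (here refl) _ = refl
  pairwise-disjoint-meets⇒≡ (e∦ ∷ _)       (here refl) (there f∈)  m = ⊥-elim (All.lookup e∦ f∈ m)
  pairwise-disjoint-meets⇒≡ (f∦ ∷ _)       (there e∈)  (here refl) m = ⊥-elim (All.lookup f∦ e∈ (meets-sym _ _ m))
  pairwise-disjoint-meets⇒≡ (_ ∷ disj)     (there e∈)  (there f∈)  m = pairwise-disjoint-meets⇒≡ disj e∈ f∈ m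

  module _ (M : MaximalMatching) where
    open MaximalMatching M

    maximalMatching-isEDS : IsEdgeDominating G (pairSet edges)
    maximalMatching-isEDS = edge-set , λ u v uv → inj₂ (meeting-pair (dominating u v uv))
      where
      edge-set : IsEdgeSet G (pairSet edges)
      edge-set u v uv∈ = All.lookup all-edges (pairSet⁻ uv∈)
      meeting-pair : ∀ {u v} → Any (λ e → Meets e (u , v)) edges →
                     ∃[ p ] ∃[ q ] (pairSet edges p q ≡ true × Meets (p , q) (u , v))
      meeting-pair m with find m
      ... | (p , q) , pq∈ , meets = p , q , pairSet⁺ pq∈ , meets

    maximalMatching-isMinimalEDS : IsMinimalEDS G (pairSet edges)
    maximalMatching-isMinimalEDS = maximalMatching-isEDS , minimal
      where
      minimal : ∀ F′ → _⊆_ G F′ (pairSet edges) → IsEdgeDominating G F′ → _⊆_ G (pairSet edges) F′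
      minimal F′ F′⊆ (_ , dom′) u v uv∈ with dom′ u v (proj₁ maximalMatching-isEDS u v uv∈)
      ... | inj₁ uv∈F′ = uv∈F′
      ... | inj₂ (p , q , pq∈F′ , meets) =
        subst (λ e → F′ (proj₁ e) (proj₂ e) ≡ true)
              (pairwise-disjoint-meets⇒≡ pairwise-disjoint (pairSet⁻ (F′⊆ p q pq∈F′)) (pairSet⁻ uv∈) meets)
              pq∈F′

  different-sizes⇒¬WellEdgeDominated : (M M′ : MaximalMatching) →
    length (MaximalMatching.edges M) ≢ length (MaximalMatching.edges M′) → ¬ WellEdgeDominated G
  different-sizes⇒¬WellEdgeDominated M M′ ≢-length wed = ≢-length (begin
    length (edges M)        ≡⟨ sym (card-pairSet (pairwise-disjoint⇒unique (pairwise-disjoint M))) ⟩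
    card G (pairSet (edges M))  ≡⟨ wed _ _ (maximalMatching-isMinimalEDS M) (maximalMatching-isMinimalEDS M′) ⟩
    card G (pairSet (edges M′)) ≡⟨ card-pairSet (pairwise-disjoint⇒unique (pairwise-disjoint M′)) ⟩
    length (edges M′) ∎)
    where
    open ≡-Reasoning
    open MaximalMatching

data AnchorView (a b k : ℕ) : ℕ → Set where
  at-x : k < a → AnchorView a b k 0
  at-y : a ≤ k → k < a + b → AnchorView a b k 1
  at-z : a + b ≤ k → AnchorView a b k 2

anchor-view : ∀ a b m → AnchorView a b (m ∸ 3) (anchor a b m)
anchor-view a b m with (m ∸ 3) <ᵇ a | <ᵇ-reflects-< (m ∸ 3) a
... | true  | ofʸ k<a = at-x k<a
... | false | ofⁿ k≮a with (m ∸ 3) <ᵇ a + b | <ᵇ-reflects-< (m ∸ 3) (a + b)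
...   | true  | ofʸ k<a+b = at-y (≮⇒≥ k≮a) k<a+b
...   | false | ofⁿ k≮a+b = at-z (≮⇒≥ k≮a+b)

anchor<3 : ∀ a b m → anchor a b m < 3
anchor<3 a b m with anchor a b m | anchor-view a b m
... | _ | at-x _   = z<s
... | _ | at-y _ _ = s<s z<s
... | _ | at-z _   = s<s (s<s z<s)

anchor-≢ᵇ-leaf : ∀ a b m k → (anchor a b m ≡ᵇ 3 + k) ≡ false
anchor-≢ᵇ-leaf a b m k with anchor a b m | anchor-view a b m
... | _ | at-x _   = refl
... | _ | at-y _ _ = refl
... | _ | at-z _   = refl

adj-anchor : ∀ a b k → adjℕ a b (anchor a b (3 + k)) (3 + k) ≡ true
adj-anchor a b k with anchor a b (3 + k) | anchor-view a b (3 + k)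
... | _ | at-x _   = refl
... | _ | at-y _ _ = refl
... | _ | at-z _   = refl

anchor-y : ∀ a b k → a ≤ k → k < a + b → anchor a b (3 + k) ≡ 1
anchor-y a b k a≤k k<a+b with anchor a b (3 + k) | anchor-view a b (3 + k)
... | _ | at-x k<a     = ⊥-elim (<⇒≱ k<a a≤k)
... | _ | at-y _ _     = refl
... | _ | at-z a+b≤k   = ⊥-elim (<⇒≱ k<a+b a+b≤k)

anchor-z : ∀ a b k → a + b ≤ k → anchor a b (3 + k) ≡ 2
anchor-z a b k a+b≤k with anchor a b (3 + k) | anchor-view a b (3 + k)
... | _ | at-x k<a     = ⊥-elim (<⇒≱ k<a (≤-trans (m≤m+n a b) a+b≤k))
... | _ | at-y _ k<a+b = ⊥-elim (<⇒≱ k<a+b a+b≤k)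
... | _ | at-z _       = refl

Leafless : ℕ → ℕ → ℕ → ℕ → Set
Leafless a b c r = ∀ k → 3 + k < 3 + a + b + c → anchor a b (3 + k) ≢ r

leafless-x : ∀ b c → Leafless 0 b c 0
leafless-x b c k _ with anchor 0 b (3 + k) | anchor-view 0 b (3 + k)
... | _ | at-y _ _ = λ ()
... | _ | at-z _   = λ ()

leafless-y : ∀ a c → Leafless a 0 c 1
leafless-y a c k _ with anchor a 0 (3 + k) | anchor-view a 0 (3 + k)
... | _ | at-x _       = λ ()
... | _ | at-y a≤k k<a = λ _ → <⇒≱ (subst (k <_) (+-identityʳ a) k<a) a≤k
... | _ | at-z _       = λ ()

leafless-z : ∀ a b → Leafless a b 0 2
leafless-z a b k (s≤s (s≤s (s≤s k<a+b))) with anchor a b (3 + k) | anchor-view a b (3 + k)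
... | _ | at-x _     = λ ()
... | _ | at-y _ _   = λ ()
... | _ | at-z a+b≤k = λ _ → <⇒≱ (subst (k <_) (+-identityʳ (a + b)) k<a+b) a+b≤k

≡ᵇ-sound : ∀ {m n} → (m ≡ᵇ n) ≡ true → m ≡ n
≡ᵇ-sound {m} {n} eq = ≡ᵇ⇒≡ m n (Equivalence.from T-≡ eq)

leaf-neighbour≡anchor : ∀ a b u k → adjℕ a b u (3 + k) ≡ true → anchor a b (3 + k) ≡ u
leaf-neighbour≡anchor a b 0 k adj = ≡ᵇ-sound adj
leaf-neighbour≡anchor a b 1 k adj = ≡ᵇ-sound adj
leaf-neighbour≡anchor a b 2 k adj = ≡ᵇ-sound adj
leaf-neighbour≡anchor a b (suc (suc (suc j))) k adj
  with () ← trans (sym adj) (cong₂ _∨_ (anchor-≢ᵇ-leaf a b (3 + j) k) (anchor-≢ᵇ-leaf a b (3 + k) j))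

data EdgeView (a b : ℕ) : ℕ → ℕ → Set where
  xy      : EdgeView a b 0 1
  xz      : EdgeView a b 0 2
  yz      : EdgeView a b 1 2
  pendant : ∀ k → EdgeView a b (anchor a b (3 + k)) (3 + k)

edge-view : ∀ a b {u v} → u < v → adjℕ a b u v ≡ true → EdgeView a b u v
edge-view a b {0} {1} _ _ = xy
edge-view a b {0} {2} _ _ = xz
edge-view a b {1} {2} _ _ = yz
edge-view a b {u} {suc (suc (suc k))} _ adj =
  subst (λ w → EdgeView a b w (3 + k)) (leaf-neighbour≡anchor a b u k adj) (pendant k)
edge-view a b {suc _}       {1} (s≤s ()) _
edge-view a b {suc (suc _)} {2} (s≤s (s≤s ())) _

pendant-edgeℕ : ∀ a b m → 3 ≤ m → anchor a b m < m × adjℕ a b (anchor a b m) m ≡ true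
pendant-edgeℕ a b (suc (suc (suc k))) _ = <-≤-trans (anchor<3 a b (3 + k)) (m≤m+n 3 k) , adj-anchor a b k
pendant-edgeℕ a b 0 ()
pendant-edgeℕ a b 1 (s≤s ())
pendant-edgeℕ a b 2 (s≤s (s≤s ()))

module TriangleWithLeaves (a b c : ℕ) where

  G : Graph
  G = triangleWithLeaves a b c

  pendant-edge : ∀ {w ℓ : Vertex G} → 3 ≤ toℕ ℓ → anchor a b (toℕ ℓ) ≡ toℕ w → Edge G w ℓ
  pendant-edge {w} {ℓ} 3≤ℓ eq =
    subst (λ u → u < toℕ ℓ × adjℕ a b u (toℕ ℓ) ≡ true) eq (pendant-edgeℕ a b (toℕ ℓ) 3≤ℓ)

  Covers : List (VertexPair G) → ℕ → Set
  Covers L w = Any (λ e → toℕ (proj₁ e) ≡ w ⊎ toℕ (proj₂ e) ≡ w) L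

  dominating-if-covers-all-but : ∀ {L} r → Leafless a b c r → (∀ w → w < 3 → w ≢ r → Covers L w) →
                                Dominating G L
  dominating-if-covers-all-but {L} r leafless cover u v (u<v , adj) =
    covers⇒meets (covered-end (edge-view a b u<v adj) (toℕ<n v))
    where
    covers-one-end : ∀ {s t} → s < 3 → t < 3 → s ≢ t → Covers L s ⊎ Covers L t
    covers-one-end {s} {t} s<3 t<3 s≢t with s ≟ℕ r
    ... | yes refl = inj₂ (cover t t<3 (s≢t ∘ sym))
    ... | no s≢r   = inj₁ (cover s s<3 s≢r)
    covered-end : ∀ {s t} → EdgeView a b s t → t < 3 + a + b + c → Covers L s ⊎ Covers L t
    covered-end xy          _   = covers-one-end z<s (s<s z<s) (λ ())
    covered-end xz          _   = covers-one-end z<s (s<s (s<s z<s)) (λ ())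
    covered-end yz          _   = covers-one-end (s<s z<s) (s<s (s<s z<s)) (λ ())
    covered-end (pendant k) k<N = inj₁ (cover _ (anchor<3 a b (3 + k)) (leafless k k<N))
    covers⇒meets : Covers L (toℕ u) ⊎ Covers L (toℕ v) → Any (λ e → Meets G e (u , v)) L
    covers⇒meets (inj₁ covers-u) = Any.map
      (λ { (inj₁ p≡u) → inj₁ (toℕ-injective p≡u)
         ; (inj₂ q≡u) → inj₂ (inj₂ (inj₁ (toℕ-injective q≡u))) })
      covers-u
    covers⇒meets (inj₂ covers-v) = Any.map
      (λ { (inj₁ p≡v) → inj₂ (inj₁ (toℕ-injective p≡v))
         ; (inj₂ q≡v) → inj₂ (inj₂ (inj₂ (toℕ-injective q≡v))) })
      covers-v

  dominating-if-covers-triangle : ∀ {L} → Covers L 0 → Covers L 1 → Covers L 2 → Dominating G L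
  dominating-if-covers-triangle {L} covers-x covers-y covers-z =
    dominating-if-covers-all-but 3 (λ k _ → <⇒≢ (anchor<3 a b (3 + k))) cover
    where
    -- 3 is not a triangle vertex, so no triangle vertex is exempted.
    cover : ∀ w → w < 3 → w ≢ 3 → Covers L w
    cover 0 _ _ = covers-x
    cover 1 _ _ = covers-y
    cover 2 _ _ = covers-z
    cover (suc (suc (suc _))) (s≤s (s≤s (s≤s ()))) _

xy-matching : ∀ a b → MaximalMatching (triangleWithLeaves a b 0)
xy-matching a b = record
  { edges             = (# 0 , # 1) ∷ []
  ; all-edges         = (z<s , refl) ∷ []
  ; pairwise-disjoint = [] ∷ []
  ; dominating        = dominating-if-covers-all-but 2 (leafless-z a b) cover
  }
  where
  open TriangleWithLeaves a b 0
  cover : ∀ w → w < 3 → w ≢ 2 → Covers ((# 0 , # 1) ∷ []) w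
  cover 0 _ _   = here (inj₁ refl)
  cover 1 _ _   = here (inj₂ refl)
  cover 2 _ 2≢2 = ⊥-elim (2≢2 refl)
  cover (suc (suc (suc _))) (s≤s (s≤s (s≤s ()))) _

xz-matching : ∀ a c → MaximalMatching (triangleWithLeaves a 0 c)
xz-matching a c = record
  { edges             = (# 0 , # 2) ∷ []
  ; all-edges         = (z<s , refl) ∷ []
  ; pairwise-disjoint = [] ∷ []
  ; dominating        = dominating-if-covers-all-but 1 (leafless-y a c) cover
  }
  where
  open TriangleWithLeaves a 0 c
  cover : ∀ w → w < 3 → w ≢ 1 → Covers ((# 0 , # 2) ∷ []) w
  cover 0 _ _   = here (inj₁ refl)
  cover 1 _ 1≢1 = ⊥-elim (1≢1 refl)
  cover 2 _ _   = here (inj₂ refl)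
  cover (suc (suc (suc _))) (s≤s (s≤s (s≤s ()))) _

yz-matching : ∀ b c → MaximalMatching (triangleWithLeaves 0 b c)
yz-matching b c = record
  { edges             = (# 1 , # 2) ∷ []
  ; all-edges         = (s<s z<s , refl) ∷ []
  ; pairwise-disjoint = [] ∷ []
  ; dominating        = dominating-if-covers-all-but 0 (leafless-x b c) cover
  }
  where
  open TriangleWithLeaves 0 b c
  cover : ∀ w → w < 3 → w ≢ 0 → Covers ((# 1 , # 2) ∷ []) w
  cover 0 _ 0≢0 = ⊥-elim (0≢0 refl)
  cover 1 _ _   = here (inj₁ refl)
  cover 2 _ _   = here (inj₂ refl)
  cover (suc (suc (suc _))) (s≤s (s≤s (s≤s ()))) _

x-pendant+yz-matching : ∀ a b c → MaximalMatching (triangleWithLeaves (suc a) b c)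
x-pendant+yz-matching a b c = record
  { edges             = (# 0 , # 3) ∷ (# 1 , # 2) ∷ []
  ; all-edges         = pendant-edge (s≤s (s≤s (s≤s z≤n))) refl ∷ (s<s z<s , refl) ∷ []
  ; pairwise-disjoint = (disjoint G (λ ()) (λ ()) (λ ()) (λ ()) ∷ []) ∷ [] ∷ []
  ; dominating        = dominating-if-covers-triangle
      (here (inj₁ refl)) (there (here (inj₁ refl))) (there (here (inj₂ refl)))
  }
  where open TriangleWithLeaves (suc a) b c

y-pendant+xz-matching : ∀ b c → MaximalMatching (triangleWithLeaves 0 (suc b) c)
y-pendant+xz-matching b c = record
  { edges             = (# 1 , # 3) ∷ (# 0 , # 2) ∷ []
  ; all-edges         = pendant-edge (s≤s (s≤s (s≤s z≤n))) refl ∷ (z<s , refl) ∷ []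
  ; pairwise-disjoint = (disjoint G (λ ()) (λ ()) (λ ()) (λ ()) ∷ []) ∷ [] ∷ []
  ; dominating        = dominating-if-covers-triangle
      (there (here (inj₁ refl))) (here (inj₁ refl)) (there (here (inj₂ refl)))
  }
  where open TriangleWithLeaves 0 (suc b) c

z-pendant+xy-matching : ∀ c → MaximalMatching (triangleWithLeaves 0 0 (suc c))
z-pendant+xy-matching c = record
  { edges             = (# 2 , # 3) ∷ (# 0 , # 1) ∷ []
  ; all-edges         = pendant-edge (s≤s (s≤s (s≤s z≤n))) refl ∷ (z<s , refl) ∷ []
  ; pairwise-disjoint = (disjoint G (λ ()) (λ ()) (λ ()) (λ ()) ∷ []) ∷ [] ∷ []
  ; dominating        = dominating-if-covers-triangle
      (there (here (inj₁ refl))) (there (here (inj₂ refl))) (here (inj₁ refl))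
  }
  where open TriangleWithLeaves 0 0 (suc c)

three-pendants-matching : ∀ a b c → MaximalMatching (triangleWithLeaves (suc a) (suc b) (suc c))
three-pendants-matching a b c = record
  { edges             = (# 0 , # 3) ∷ (# 1 , ℓy) ∷ (# 2 , ℓz) ∷ []
  ; all-edges         =
      pendant-edge (s≤s (s≤s (s≤s z≤n))) refl ∷
      pendant-edge (s≤s (s≤s (s≤s z≤n)))
        (trans (cong (anchor A B) (toℕ-fromℕ< ℓy<N)) (anchor-y A B A ≤-refl (m<m+n A z<s))) ∷
      pendant-edge (s≤s (s≤s (s≤s z≤n)))
        (trans (cong (anchor A B) (toℕ-fromℕ< ℓz<N)) (anchor-z A B (A + B) ≤-refl)) ∷ []
  ; pairwise-disjoint =
      (disjoint G (λ ()) (λ ()) (λ ()) (λ ()) ∷ disjoint G (λ ()) (λ ()) (λ ()) (λ ()) ∷ []) ∷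
      (disjoint G (λ ()) (λ ()) (λ ()) ℓy≢ℓz ∷ []) ∷ [] ∷ []
  ; dominating        = dominating-if-covers-triangle
      (here (inj₁ refl)) (there (here (inj₁ refl))) (there (there (here (inj₁ refl))))
  }
  where
  open TriangleWithLeaves (suc a) (suc b) (suc c)
  A = suc a
  B = suc b
  ℓy<N : 3 + A < 3 + A + B + suc c
  ℓy<N = <-≤-trans (m<m+n (3 + A) z<s) (m≤m+n (3 + A + B) (suc c))
  ℓz<N : 3 + A + B < 3 + A + B + suc c
  ℓz<N = m<m+n (3 + A + B) z<s
  ℓy ℓz : Vertex G
  ℓy = fromℕ< ℓy<N
  ℓz = fromℕ< ℓz<N
  ℓy≢ℓz : ℓy ≢ ℓz
  ℓy≢ℓz ℓy≡ℓz = <⇒≢ (m<m+n (3 + A) z<s)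
    (trans (sym (toℕ-fromℕ< ℓy<N)) (trans (cong toℕ ℓy≡ℓz) (toℕ-fromℕ< ℓz<N)))

lemma4 : (a b c : ℕ) → 4 ≤ 3 + a + b + c →
         ¬ WellEdgeDominated (triangleWithLeaves a b c)
lemma4 zero    zero    zero    (s≤s (s≤s (s≤s ())))
lemma4 (suc a) b       zero    _ = different-sizes⇒¬WellEdgeDominated _
  (xy-matching (suc a) b) (x-pendant+yz-matching a b 0) (λ ())
lemma4 zero    (suc b) zero    _ = different-sizes⇒¬WellEdgeDominated _
  (xy-matching 0 (suc b)) (y-pendant+xz-matching b 0) (λ ())
lemma4 zero    zero    (suc c) _ = different-sizes⇒¬WellEdgeDominated _
  (yz-matching 0 (suc c)) (z-pendant+xy-matching c) (λ ())
lemma4 zero    (suc b) (suc c) _ = different-sizes⇒¬WellEdgeDominated _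
  (yz-matching (suc b) (suc c)) (y-pendant+xz-matching b (suc c)) (λ ())
lemma4 (suc a) zero    (suc c) _ = different-sizes⇒¬WellEdgeDominated _
  (xz-matching (suc a) (suc c)) (x-pendant+yz-matching a 0 (suc c)) (λ ())
lemma4 (suc a) (suc b) (suc c) _ = different-sizes⇒¬WellEdgeDominated _
  (x-pendant+yz-matching a (suc b) (suc c)) (three-pendants-matching a b c) (λ ())
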